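{- If labelled asynchronous systems $(\mathcal{A},\lambda,L)$ and $(\mathcal{A}',\lambda',L)$ are $Pom_L$-bisimilar, then $H_n(\mathcal{A},\lambda,L)\cong H_n(\mathcal{A}',\lambda',L)$ for all $n\ge 0$.
   Context: A state space $(S,E,I,\mathrm{Tran})$: states $S$, events $E$, symmetric irreflexive independence $I\subseteq E\times E$, transitions $\mathrm{Tran}\subseteq S\times E\times S$, with (1) $(s,a,s'),(s,a,s'')\in\mathrm{Tran}\Rightarrow s'=s''$; (2) if $(a,b)\in I$, $(s,a,s'),(s',b,s'')\in\mathrm{Tran}$ then some $s_1$ has $(s,b,s_1),(s_1,a,s'')\in\mathrm{Tran}$. An asynchronous system $\mathcal{A}=(S,s_0,E,I,\mathrm{Tran})$ adds an initial state $s_0$, every event occurring in some transition. For a word $w=e_1\cdots e_k$, $s\cdot w\in S$ means there are $s=t_0,\dots,t_k$ with $(t_{i-1},e_i,t_i)\in\mathrm{Tran}$, and $s\cdot w=t_k$. A state is reachable if it is $s_0\cdot w$ for some word $w$ (possibly empty). A morphism $(\sigma,\eta):\mathcal{A}\to\mathcal{A}'=(S',s'_0,E',I',\mathrm{Tran}')$: total $\sigma:S\to S'$ with $\sigma(s_0)=s'_0$, partial $\eta:E\rightharpoonup E'$, such that for each $(s_1,e,s_2)\in\mathrm{Tran}$, $(\sigma(s_1),\eta(e),\sigma(s_2))\in\mathrm{Tran}'$ if $\eta(e)$ is defined and $\sigma(s_1)=\sigma(s_2)$ otherwise, and $(\eta(e_1),\eta(e_2))\in I'$ for $(e_1,e_2)\in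 I$ with both defined. It is open if (a) $\eta$ is total; (b) for every $s\in S$ and $(\sigma(s),e',u')\in\mathrm{Tran}'$ there is $(s,e,u)\in\mathrm{Tran}$ with $\eta(e)=e'$, $\sigma(u)=u'$; (c) for every reachable $s$, if $(s,e_1,u),(u,e_2,v)\in\mathrm{Tran}$ and $(\eta(e_1),\eta(e_2))\in I'$ then $(e_1,e_2)\in I$. A labelled asynchronous system $(\mathcal{A},\lambda,L)$ is an asynchronous system with a set $L$ and a map $\lambda:E\to L$. A $Pom_L$-open morphism is an open morphism with $\lambda(e)=\lambda'(\eta(e))$ for all $e\in E$. Two labelled asynchronous systems are $Pom_L$-bisimilar if some labelled asynchronous system (same $L$) has $Pom_L$-open morphisms to both. Homology: to $(\mathcal{A},\lambda,L)$ associate the simplicial scheme (abstract simplicial complex) with vertex set $\lambda^+E=\{\lambda(a): a\in E,\ s\cdot a\in S \text{ for some reachable } s\}$ and whose simplices are the finite sets $\{\lambda(a_1),\dots,\lambda(a_k)\}$, $k\ge1$ (repetitions removed), such that $(a_i,a_j)\in I$ for all $1\le i<j\le k$ and $s\cdot a_1\cdots a_k\in S$ for some reachable $s$. $H_n(\mathcal{A},\lambda,L)$ is the $n$th simplicial homology group with integer coefficients of this simplicial scheme. -}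

module Defs where

open import Level using (0ℓ)
open import Data.Nat using (ℕ; zero; suc)
open import Data.Integer using (ℤ; -_; _+_) renaming (0ℤ to zeroℤ)
open import Data.Fin using (Fin; toℕ)
open import Data.Vec using (Vec; lookup; removeAt; _[_]≔_; toList; allFin)
import Data.Vec as Vec
open import Data.List using (List; []; _∷_; _++_; map; concatMap)
open import Data.List.Relation.Unary.All using (All)
open import Data.List.Relation.Unary.AllPairs using (AllPairs)
open import Data.List.Membership.Propositional using (_∈_)
open import Data.List.Relation.Binary.Permutation.Propositional using (_↭_)
open import Data.Maybe using (Maybe; just; nothing)
open import Data.Product using (Σ; ∃; ∃-syntax; _×_; _,_; proj₁; proj₂)
open import Data.Unit using (⊤)
open import Relation.Binary.PropositionalEquality using (_≡_; _≢_)
open import Relation.Nullary using (¬_)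
open import Function.Bundles using (_⇔_)

record AsyncSystem : Set₁ where
  field
    S       : Set
    s₀      : S
    E       : Set
    I       : E → E → Set
    Tran    : S → E → S → Set
    I-sym     : ∀ {a b} → I a b → I b a
    I-irrefl  : ∀ {a} → ¬ I a a
    Tran-det  : ∀ {s a s′ s″} → Tran s a s′ → Tran s a s″ → s′ ≡ s″
    Tran-diam : ∀ {a b s s′ s″} → I a b → Tran s a s′ → Tran s′ b s″ →
                ∃[ s₁ ] (Tran s b s₁ × Tran s₁ a s″)
    E-occurs  : ∀ e → ∃[ s ] ∃[ s′ ] Tran s e s′

  -- Run s w t  :  s · w ∈ S  and  s · w = t
  data Run : S → List E → S → Set where
    run-[] : ∀ {s} → Run s [] s
    run-∷  : ∀ {s a t w u} → Tran s a t → Run t w u → Run s (a ∷ w) u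

  Reachable : S → Set
  Reachable s = ∃[ w ] Run s₀ w s

open AsyncSystem

record Morphism (A A′ : AsyncSystem) : Set where
  field
    σ : S A → S A′
    η : E A → Maybe (E A′)
    σ-init : σ (s₀ A) ≡ s₀ A′
    tran-def   : ∀ {s₁ e s₂ e′} → Tran A s₁ e s₂ → η e ≡ just e′ →
                 Tran A′ (σ s₁) e′ (σ s₂)
    tran-undef : ∀ {s₁ e s₂} → Tran A s₁ e s₂ → η e ≡ nothing → σ s₁ ≡ σ s₂
    indep      : ∀ {e₁ e₂ e₁′ e₂′} → I A e₁ e₂ → η e₁ ≡ just e₁′ →
                 η e₂ ≡ just e₂′ → I A′ e₁′ e₂′

record IsOpen {A A′ : AsyncSystem} (m : Morphism A A′) : Set where
  open Morphism m
  field
    total  : ∀ e → ∃[ e′ ] (η e ≡ just e′)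
    lift   : ∀ s {e′ u′} → Tran A′ (σ s) e′ u′ →
             ∃[ e ] ∃[ u ] (Tran A s e u × η e ≡ just e′ × σ u ≡ u′)
    reflI  : ∀ {s e₁ u e₂ v e₁′ e₂′} → Reachable A s → Tran A s e₁ u → Tran A u e₂ v →
             η e₁ ≡ just e₁′ → η e₂ ≡ just e₂′ → I A′ e₁′ e₂′ → I A e₁ e₂

record LabelledAsync (L : Set) : Set₁ where
  field
    sys : AsyncSystem
    lab : E sys → L

open LabelledAsync

record PomOpen {L : Set} (X Y : LabelledAsync L) : Set where
  field
    mor    : Morphism (sys X) (sys Y)
    isOpen : IsOpen mor
    labels : ∀ e {e′} → Morphism.η mor e ≡ just e′ → lab X e ≡ lab Y e′

PomBisimilar : {L : Set} → LabelledAsync L → LabelledAsync L → Set₁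
PomBisimilar {L} X Y = Σ (LabelledAsync L) λ Z → PomOpen Z X × PomOpen Z Y

IsSimplex : {L : Set} → LabelledAsync L → List L → Set
IsSimplex X vs =
  ∃[ as ] (as ≢ [] × AllPairs (I A) as ×
           (∃[ s ] ∃[ t ] (Reachable A s × Run A s as t)) ×
           (∀ x → (x ∈ vs) ⇔ (x ∈ map (lab X) as)))
  where A = sys X

-- An n-chain is a formal ℤ-combination of ordered (n+1)-tuples of vertices,
-- modulo: abelian group laws, sign change under a transposition, and
-- vanishing of tuples with a repeated vertex.

Tuple : Set → ℕ → Set
Tuple V n = Vec V (suc n)

Chain : Set → ℕ → Set
Chain V n = List (ℤ × Tuple V n)

data _≈C_ {V : Set} {n : ℕ} : Chain V n → Chain V n → Set where
  ≈-refl  : ∀ {c} → c ≈C c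
  ≈-sym   : ∀ {c c′} → c ≈C c′ → c′ ≈C c
  ≈-trans : ∀ {c c′ c″} → c ≈C c′ → c′ ≈C c″ → c ≈C c″
  ≈-perm  : ∀ {c c′} → c ↭ c′ → c ≈C c′
  ≈-++    : ∀ {c₁ c₁′ c₂ c₂′} → c₁ ≈C c₁′ → c₂ ≈C c₂′ → (c₁ ++ c₂) ≈C (c₁′ ++ c₂′)
  ≈-merge : ∀ a b v → ((a , v) ∷ (b , v) ∷ []) ≈C ((a + b , v) ∷ [])
  ≈-zero  : ∀ v → ((zeroℤ , v) ∷ []) ≈C []
  ≈-swap  : ∀ a v (i j : Fin (suc n)) → i ≢ j →
            ((a , v) ∷ []) ≈C ((- a , (v [ i ]≔ lookup v j) [ j ]≔ lookup v i) ∷ [])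
  ≈-degen : ∀ a v (i j : Fin (suc n)) → i ≢ j → lookup v i ≡ lookup v j →
            ((a , v) ∷ []) ≈C []

negC : {V : Set} {n : ℕ} → Chain V n → Chain V n
negC = map (λ { (a , v) → (- a , v) })

alt : ℕ → ℤ → ℤ
alt zero    a = a
alt (suc k) a = - alt k a

∂tuple : {V : Set} {n : ℕ} → ℤ × Tuple V (suc n) → Chain V n
∂tuple (a , v) = toList (Vec.map (λ i → (alt (toℕ i) a , removeAt v i)) (allFin _))

∂ : {V : Set} {n : ℕ} → Chain V (suc n) → Chain V n
∂ = concatMap ∂tuple

-- Simplicial homology of a simplicial scheme given by a predicate on
-- finite lists of vertices (a tuple lies in the complex iff its set of
-- vertices is a simplex).

module Homology {V : Set} (Simp : List V → Set) where

  Supported : {n : ℕ} → Chain V n → Set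
  Supported c = All (λ p → Simp (toList (proj₂ p))) c

  IsCycle : (n : ℕ) → Chain V n → Set
  IsCycle zero    c = ⊤
  IsCycle (suc n) c = ∂ c ≈C []

  Cycle : ℕ → Set
  Cycle n = Σ (Chain V n) λ c → Supported c × IsCycle n c

  _∼_ : {n : ℕ} → Cycle n → Cycle n → Set
  _∼_ {n} (c , _) (c′ , _) =
    ∃[ d ] (Supported {suc n} d × (c ++ negC c′) ≈C ∂ d)

-- An isomorphism H_n(K) ≅ H_n(K′) of abelian groups, H_n = Z_n / ∼ with
-- addition induced by concatenation of chains.
record HomologyIso {V : Set} (Simp Simp′ : List V → Set) (n : ℕ) : Set where
  module H  = Homology Simp
  module H′ = Homology Simp′
  field
    to      : H.Cycle n → H′.Cycle n
    from    : H′.Cycle n → H.Cycle n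
    to-cong   : ∀ {x y} → x H.∼ y → to x H′.∼ to y
    from-cong : ∀ {x y} → x H′.∼ y → from x H.∼ from y
    to-hom  : ∀ x y z → proj₁ z ≡ proj₁ x ++ proj₁ y →
              ∀ w → proj₁ w ≡ proj₁ (to x) ++ proj₁ (to y) → to z H′.∼ w
    from-to : ∀ x → from (to x) H.∼ x
    to-from : ∀ y → to (from y) H′.∼ y

H-Iso : {L : Set} → LabelledAsync L → LabelledAsync L → ℕ → Set
H-Iso X Y n = HomologyIso (IsSimplex X) (IsSimplex Y) n

-- The simplicial scheme of a labelled asynchronous system is itself a Pom_L-bisimulation
-- invariant, so both homologies are computed from one and the same chain complex.
-- A Pom_L-open morphism Z → X sends a reachable run of pairwise independent events to one
-- in X with the same labels; conversely, a reachable run in X lifts step by step to a run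
-- in Z, and the lifted events are pairwise independent because open morphisms reflect
-- independence of consecutive events, while the diamond property makes any two events of
-- an independent run consecutive from a reachable state.
module Submission where

open import Defs
open import Data.Nat using (ℕ)
open import Data.Integer using (-_)
open import Data.Integer.Properties using (+-inverseʳ)
open import Data.List using (List; []; _∷_; _++_; map)
open import Data.List.Properties using (map-∘; map-cong)
open import Data.List.Membership.Propositional using (_∈_)
open import Data.List.Relation.Unary.All as All using (All; []; _∷_)
open import Data.List.Relation.Unary.AllPairs as AllPairs using (AllPairs; []; _∷_)
import Data.List.Relation.Unary.AllPairs.Properties as AllPairsₚ
open import Data.List.Relation.Binary.Pointwise using (Pointwise; []; _∷_)
open import Data.List.Relation.Binary.Permutation.Propositional using (prep)
open import Data.List.Relation.Binary.Permutation.Propositional.Properties using (shift)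
open import Data.Maybe using (just)
open import Data.Product using (∃-syntax; _×_; _,_; proj₁; proj₂)
open import Relation.Binary.PropositionalEquality using (_≡_; _≢_; refl; sym; trans; subst)
open import Function.Base using (_∘_)
open import Function.Bundles using (_⇔_; Equivalence; mk⇔)
open import Function.Construct.Symmetry using (⇔-sym)
open import Function.Construct.Composition using (_⇔-∘_)
open AsyncSystem
open LabelledAsync

++-negC-≈[] : {V : Set} {n : ℕ} (c : Chain V n) → (c ++ negC c) ≈C []
++-negC-≈[] [] = ≈-refl
++-negC-≈[] ((a , v) ∷ c) =
  ≈-trans (≈-perm (prep (a , v) (shift (- a , v) c (negC c))))
          (≈-++ {c₁ = (a , v) ∷ (- a , v) ∷ []} a-a≈[] (++-negC-≈[] c))
  where
  a-a≈[] : ((a , v) ∷ (- a , v) ∷ []) ≈C []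
  a-a≈[] = ≈-trans (≈-merge a (- a) v)
                   (subst (λ z → ((z , v) ∷ []) ≈C []) (sym (+-inverseʳ a)) (≈-zero v))

homologyIso-⇔ : {V : Set} {Simp Simp′ : List V → Set} →
                (∀ vs → Simp vs ⇔ Simp′ vs) → (n : ℕ) → HomologyIso Simp Simp′ n
homologyIso-⇔ {Simp = Simp} {Simp′} Simp⇔Simp′ n = record
  { to        = λ { (c , sc , zc) → c , All.map (to _) sc , zc }
  ; from      = λ { (c , sc , zc) → c , All.map (from _) sc , zc }
  ; to-cong   = λ { (d , sd , eq) → d , All.map (to _) sd , eq }
  ; from-cong = λ { (d , sd , eq) → d , All.map (from _) sd , eq }
  ; to-hom    = λ { _ _ (c , _) c≡ (w , _) w≡ →
                    [] , [] , subst (λ k → (c ++ negC k) ≈C []) (trans c≡ (sym w≡)) (++-negC-≈[] c) }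
  ; from-to   = λ { (c , _) → [] , [] , ++-negC-≈[] c }
  ; to-from   = λ { (c , _) → [] , [] , ++-negC-≈[] c }
  }
  where
  to : ∀ vs → Simp vs → Simp′ vs
  to vs = Equivalence.to (Simp⇔Simp′ vs)

  from : ∀ vs → Simp′ vs → Simp vs
  from vs = Equivalence.from (Simp⇔Simp′ vs)

module _ {A : AsyncSystem} where

  Run-snoc : ∀ {s w t b u} → Run A s w t → Tran A t b u → Run A s (w ++ b ∷ []) u
  Run-snoc run-[]       t→u = run-∷ t→u run-[]
  Run-snoc (run-∷ s→ r) t→u = run-∷ s→ (Run-snoc r t→u)

  Reachable-step : ∀ {s b u} → Reachable A s → Tran A s b u → Reachable A u
  Reachable-step (w , r) s→u = w ++ _ ∷ [] , Run-snoc r s→u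

module PomOpenSimplices {L : Set} {Z X : LabelledAsync L} (p : PomOpen Z X) where
  open PomOpen p
  open Morphism mor
  open IsOpen isOpen

  private
    AZ = sys Z
    AX = sys X

  η̂ : E AZ → E AX
  η̂ e = proj₁ (total e)

  η≡η̂ : ∀ e → η e ≡ just (η̂ e)
  η≡η̂ e = proj₂ (total e)

  Over : List (E AZ) → List (E AX) → Set
  Over = Pointwise (λ e e′ → η e ≡ just e′)

  Run-map : ∀ {s as t} → Run AZ s as t → Run AX (σ s) (map η̂ as) (σ t)
  Run-map run-[]        = run-[]
  Run-map (run-∷ s→ r) = run-∷ (tran-def s→ (η≡η̂ _)) (Run-map r)

  Reachable-map : ∀ {s} → Reachable AZ s → Reachable AX (σ s)
  Reachable-map (w , r) = map η̂ w , subst (λ s₀′ → Run AX s₀′ (map η̂ w) _) σ-init (Run-map r)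

  AllPairs-I-map : ∀ {as} → AllPairs (I AZ) as → AllPairs (I AX) (map η̂ as)
  AllPairs-I-map = AllPairsₚ.map⁺ ∘ AllPairs.map (λ i → indep i (η≡η̂ _) (η≡η̂ _))

  map-lab-η̂ : ∀ as → map (lab X) (map η̂ as) ≡ map (lab Z) as
  map-lab-η̂ as = trans (sym (map-∘ as)) (map-cong (λ a → sym (labels a (η≡η̂ a))) as)

  Run-lift : ∀ s {w t′} → Run AX (σ s) w t′ →
             ∃[ ws ] ∃[ t ] (Run AZ s ws t × Over ws w × σ t ≡ t′)
  Run-lift s run-[] = [] , s , run-[] , [] , refl
  Run-lift s (run-∷ σs→ r) with lift s σs→
  ... | e , u , s→u , ηe , refl with Run-lift u r
  ... | ws , t , r′ , over , σt≡ = e ∷ ws , t , run-∷ s→u r′ , ηe ∷ over , σt≡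

  -- Independence of a with b is reflected at the state reached after a; the diamond then
  -- moves b in front of a, so a again fires from a reachable state before the rest.
  All-I-reflect : ∀ {s a u bs t a′ bs′} → Reachable AZ s → Tran AZ s a u → Run AZ u bs t →
                  η a ≡ just a′ → Over bs bs′ → All (I AX a′) bs′ → All (I AZ a) bs
  All-I-reflect _ _ run-[] _ [] [] = []
  All-I-reflect reach s→u (run-∷ u→ r) ηa (ηb ∷ over) (Ia′b′ ∷ rest) =
    let Iab = reflI reach s→u u→ ηa ηb Ia′b′
        (_ , s→s₁ , s₁→) = Tran-diam AZ Iab s→u u→
    in Iab ∷ All-I-reflect (Reachable-step reach s→s₁) s₁→ r ηa over rest

  AllPairs-I-reflect : ∀ {s as t as′} → Reachable AZ s → Run AZ s as t → Over as as′ →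
                       AllPairs (I AX) as′ → AllPairs (I AZ) as
  AllPairs-I-reflect _ run-[] [] [] = []
  AllPairs-I-reflect reach (run-∷ s→ r) (ηa ∷ over) (Ia′ ∷ I-rest) =
    All-I-reflect reach s→ r ηa over Ia′ ∷ AllPairs-I-reflect (Reachable-step reach s→) r over I-rest

  map-lab-Over : ∀ {as as′} → Over as as′ → map (lab Z) as ≡ map (lab X) as′
  map-lab-Over [] = refl
  map-lab-Over {a ∷ _} (ηa ∷ over) rewrite labels a ηa | map-lab-Over over = refl

  private
    ≢[]-map : ∀ {B : Set} (f : E AZ → B) {as} → as ≢ [] → map f as ≢ []
    ≢[]-map f {[]} as≢[] = λ _ → as≢[] refl
    ≢[]-map f {_ ∷ _} _ = λ ()

    ≢[]-Over : ∀ {as as′} → Over as as′ → as′ ≢ [] → as ≢ []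
    ≢[]-Over [] as′≢[] = λ _ → as′≢[] refl
    ≢[]-Over (_ ∷ _) _ = λ ()

    same-vertices : ∀ {vs} {l l′ : List L} → l ≡ l′ →
                    (∀ x → (x ∈ vs) ⇔ (x ∈ l)) → ∀ x → (x ∈ vs) ⇔ (x ∈ l′)
    same-vertices refl vs⇔l = vs⇔l

  IsSimplex-preserve : ∀ vs → IsSimplex Z vs → IsSimplex X vs
  IsSimplex-preserve vs (as , as≢[] , indep-as , (s , t , reach , r) , vs⇔as) =
    map η̂ as , ≢[]-map η̂ as≢[] , AllPairs-I-map indep-as ,
    (σ s , σ t , Reachable-map reach , Run-map r) ,
    same-vertices (sym (map-lab-η̂ as)) vs⇔as

  IsSimplex-reflect : ∀ vs → IsSimplex X vs → IsSimplex Z vs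
  IsSimplex-reflect vs (as′ , as′≢[] , indep-as′ , (s′ , t′ , (w , r₀) , r) , vs⇔as′)
    with Run-lift (s₀ AZ) (subst (λ s₀′ → Run AX s₀′ w s′) (sym σ-init) r₀)
  ... | w̃ , s , r̃₀ , _ , refl with Run-lift s r
  ... | as , t , r̃ , over , _ =
    as , ≢[]-Over over as′≢[] , AllPairs-I-reflect (w̃ , r̃₀) r̃ over indep-as′ ,
    (s , t , (w̃ , r̃₀) , r̃) ,
    same-vertices (sym (map-lab-Over over)) vs⇔as′

  IsSimplex⇔ : ∀ vs → IsSimplex Z vs ⇔ IsSimplex X vs
  IsSimplex⇔ vs = mk⇔ (IsSimplex-preserve vs) (IsSimplex-reflect vs)

mainTheorem6 : {L : Set} (X Y : LabelledAsync L) → PomBisimilar X Y → (n : ℕ) → H-Iso X Y n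
mainTheorem6 X Y (Z , Z→X , Z→Y) =
  homologyIso-⇔ λ vs → IsSimplex⇔ Z→Y vs ⇔-∘ ⇔-sym (IsSimplex⇔ Z→X vs)
  where open PomOpenSimplices using (IsSimplex⇔)
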